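{- Let $A$ be a real symmetric $n\times n$ matrix and $i\in[n]$. If $A$ has the $i$-SNIP, then both $A$ and $A(i)$ have the SAP.
   Context: $A(i)$ is $A$ with row and column $i$ deleted. A symmetric matrix $M$ has the strong Arnold property (SAP) if $X=O$ is the only real symmetric $X$ with $M\circ X=O$, $I\circ X=O$ and $MX=O$ ($\circ$ the entrywise product). $A$ has the $i$-SNIP if $X=O$ is the only real symmetric $X$ with $A\circ X=O$, $I\circ X=O$ and $(AX)(i,:]=O$, where $(AX)(i,:]$ is $AX$ with row $i$ deleted. -}

module Defs where

open import Level using (_⊔_)
open import Data.Nat using (ℕ; suc)
open import Data.Fin using (Fin; punchIn)
open import Relation.Nullary using (¬_)
open import Relation.Binary.PropositionalEquality using (_≡_)
open import Algebra.Bundles using (CommutativeRing)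
import Algebra.Definitions.RawMonoid as RawMonoidDefs

module MatrixDefs {c ℓ} (R : CommutativeRing c ℓ) where
  open CommutativeRing R

  Matrix : ℕ → Set c
  Matrix n = Fin n → Fin n → Carrier

  Σ : ∀ {n} → (Fin n → Carrier) → Carrier
  Σ = RawMonoidDefs.sum +-rawMonoid

  _·_ : ∀ {n} → Matrix n → Matrix n → Matrix n
  (M · X) j k = Σ (λ l → M j l * X l k)

  Symmetric : ∀ {n} → Matrix n → Set ℓ
  Symmetric M = ∀ j k → M j k ≈ M k j

  HadamardZero : ∀ {n} → Matrix n → Matrix n → Set ℓ
  HadamardZero M X = ∀ j k → M j k * X j k ≈ 0#

  -- I ∘ X = O  (zero diagonal)
  DiagZero : ∀ {n} → Matrix n → Set ℓ
  DiagZero X = ∀ j → X j j ≈ 0#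

  IsZero : ∀ {n} → Matrix n → Set ℓ
  IsZero X = ∀ j k → X j k ≈ 0#

  delete : ∀ {m} → Fin (suc m) → Matrix (suc m) → Matrix m
  delete i A j k = A (punchIn i j) (punchIn i k)

  SAP : ∀ {n} → Matrix n → Set (c ⊔ ℓ)
  SAP {n} M = (X : Matrix n) → Symmetric X → HadamardZero M X → DiagZero X →
              IsZero (M · X) → IsZero X

  -- (AX)(i,:] = O : all rows of AX except row i vanish
  ZeroOffRow : ∀ {n} → Fin n → Matrix n → Set ℓ
  ZeroOffRow i Y = ∀ j k → ¬ (j ≡ i) → Y j k ≈ 0#

  SNIP : ∀ {n} → Fin n → Matrix n → Set (c ⊔ ℓ)
  SNIP {n} i A = (X : Matrix n) → Symmetric X → HadamardZero A X → DiagZero X →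
                 ZeroOffRow i (A · X) → IsZero X

-- A matrix X meeting the SAP conditions for A (in particular AX = O) meets the
-- i-SNIP conditions, which only ask for the rows of AX other than row i to
-- vanish.  A test matrix X for the SAP of A(i) is turned into one for
-- the i-SNIP of A by padding it with a zero row and column i: for j, k ≠ i the
-- entry (A Y)(j,k) is (A(i) X)(j,k) because row i of Y is zero, and column i of
-- A Y is zero because column i of Y is.
module Submission where

open import Defs
open import Data.Nat using (ℕ; suc)
open import Data.Fin using (Fin; punchIn; punchOut; _≟_)
open import Data.Fin.Properties using (punchInᵢ≢i; punchIn-punchOut; punchOut-punchIn; punchOut-cong)
open import Data.Product using (_×_; _,_)
open import Algebra.Bundles using (CommutativeRing)
open import Relation.Binary.PropositionalEquality as ≡ using (_≡_; _≢_)
open import Relation.Nullary using (yes; no; contradiction)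
import Algebra.Properties.CommutativeMonoid.Sum as Sum

data Punched {m} (i : Fin (suc m)) : Fin (suc m) → Set where
  at : Punched i i
  punchedIn : ∀ a → Punched i (punchIn i a)

punched : ∀ {m} (i j : Fin (suc m)) → Punched i j
punched i j with i ≟ j
... | yes ≡.refl = at
... | no i≢j = ≡.subst (Punched i) (punchIn-punchOut i≢j) (punchedIn (punchOut i≢j))

punchOut-punchIn′ : ∀ {m} (i : Fin (suc m)) {a : Fin m} (i≢a : i ≢ punchIn i a) →
                    punchOut i≢a ≡ a
punchOut-punchIn′ i i≢a = ≡.trans (punchOut-cong i ≡.refl) (punchOut-punchIn i)

module _ {c ℓ} (R : CommutativeRing c ℓ) where
  open CommutativeRing R
  open MatrixDefs R
  open Sum +-commutativeMonoid using (sum-remove; sum-cong-≋; sum-replicate-zero)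
  open import Relation.Binary.Reasoning.Setoid setoid

  Σ-zero : ∀ {m} (f : Fin m → Carrier) → (∀ l → f l ≈ 0#) → Σ f ≈ 0#
  Σ-zero {m} f f≈0 = trans (sum-cong-≋ f≈0) (sum-replicate-zero m)

  extendByZero : ∀ {m} → Fin (suc m) → Matrix m → Matrix (suc m)
  extendByZero i X j k with i ≟ j | i ≟ k
  ... | no i≢j | no i≢k = X (punchOut i≢j) (punchOut i≢k)
  ... | _      | _      = 0#

  module _ {m} (i : Fin (suc m)) (X : Matrix m) where
    private
      Y : Matrix (suc m)
      Y = extendByZero i X

    extendByZero-rowᵢ : ∀ k → Y i k ≈ 0#
    extendByZero-rowᵢ k with i ≟ i | i ≟ k
    ... | yes _  | _ = refl
    ... | no i≢i | _ = contradiction ≡.refl i≢i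

    extendByZero-colᵢ : ∀ j → Y j i ≈ 0#
    extendByZero-colᵢ j with i ≟ j | i ≟ i
    ... | yes _ | _      = refl
    ... | no _  | yes _  = refl
    ... | no _  | no i≢i = contradiction ≡.refl i≢i

    extendByZero-punchIn : ∀ a b → Y (punchIn i a) (punchIn i b) ≈ X a b
    extendByZero-punchIn a b with i ≟ punchIn i a | i ≟ punchIn i b
    ... | yes i≡a | _       = contradiction (≡.sym i≡a) (punchInᵢ≢i i a)
    ... | no _    | yes i≡b = contradiction (≡.sym i≡b) (punchInᵢ≢i i b)
    ... | no i≢a  | no i≢b  =
      reflexive (≡.cong₂ X (punchOut-punchIn′ i i≢a) (punchOut-punchIn′ i i≢b))

    extendByZero-symmetric : Symmetric X → Symmetric Y
    extendByZero-symmetric X-sym j k with punched i j | punched i k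
    ... | at          | _           = trans (extendByZero-rowᵢ k) (sym (extendByZero-colᵢ k))
    ... | punchedIn _ | at          = trans (extendByZero-colᵢ j) (sym (extendByZero-rowᵢ j))
    ... | punchedIn a | punchedIn b = begin
      Y (punchIn i a) (punchIn i b) ≈⟨ extendByZero-punchIn a b ⟩
      X a b                         ≈⟨ X-sym a b ⟩
      X b a                         ≈⟨ extendByZero-punchIn b a ⟨
      Y (punchIn i b) (punchIn i a) ∎

    extendByZero-diagZero : DiagZero X → DiagZero Y
    extendByZero-diagZero X-diag j with punched i j
    ... | at          = extendByZero-rowᵢ i
    ... | punchedIn a = trans (extendByZero-punchIn a a) (X-diag a)

    extendByZero-hadamardZero : ∀ (A : Matrix (suc m)) →
                                HadamardZero (delete i A) X → HadamardZero A Y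
    extendByZero-hadamardZero A AX≈0 j k with punched i j | punched i k
    ... | at          | _           = trans (*-congˡ (extendByZero-rowᵢ k)) (zeroʳ _)
    ... | punchedIn _ | at          = trans (*-congˡ (extendByZero-colᵢ j)) (zeroʳ _)
    ... | punchedIn a | punchedIn b = trans (*-congˡ (extendByZero-punchIn a b)) (AX≈0 a b)

    ·-extendByZero-colᵢ : ∀ (M : Matrix (suc m)) j → (M · Y) j i ≈ 0#
    ·-extendByZero-colᵢ M j =
      Σ-zero _ (λ l → trans (*-congˡ (extendByZero-colᵢ l)) (zeroʳ (M j l)))

    ·-extendByZero-punchIn : ∀ (M : Matrix (suc m)) j b →
                             (M · Y) j (punchIn i b) ≈ Σ (λ l → M j (punchIn i l) * X l b)
    ·-extendByZero-punchIn M j b = begin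
      (M · Y) j (punchIn i b)
        ≈⟨ sum-remove {i = i} (λ l → M j l * Y l (punchIn i b)) ⟩
      M j i * Y i (punchIn i b) + Σ (λ l → M j (punchIn i l) * Y (punchIn i l) (punchIn i b))
        ≈⟨ +-cong (trans (*-congˡ (extendByZero-rowᵢ _)) (zeroʳ _))
                  (sum-cong-≋ (λ l → *-congˡ (extendByZero-punchIn l b))) ⟩
      0# + Σ (λ l → M j (punchIn i l) * X l b)
        ≈⟨ +-identityˡ _ ⟩
      Σ (λ l → M j (punchIn i l) * X l b) ∎

  SNIP⇒SAP : ∀ {n} {i : Fin n} {A : Matrix n} → SNIP i A → SAP A
  SNIP⇒SAP snip X X-sym AX≈0 X-diag A·X≈0 = snip X X-sym AX≈0 X-diag (λ j k _ → A·X≈0 j k)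

  SNIP⇒SAP-delete : ∀ {m} {i : Fin (suc m)} {A : Matrix (suc m)} → SNIP i A → SAP (delete i A)
  SNIP⇒SAP-delete {m} {i} {A} snip X X-sym AX≈0 X-diag A·X≈0 a b = begin
    X a b                         ≈⟨ extendByZero-punchIn i X a b ⟨
    Y (punchIn i a) (punchIn i b) ≈⟨ Y≈0 (punchIn i a) (punchIn i b) ⟩
    0#                            ∎
    where
    Y : Matrix (suc m)
    Y = extendByZero i X

    A·Y-offRowᵢ : ZeroOffRow i (A · Y)
    A·Y-offRowᵢ j k j≢i with punched i j | punched i k
    ... | at          | _           = contradiction ≡.refl j≢i
    ... | punchedIn _ | at          = ·-extendByZero-colᵢ i X A _
    ... | punchedIn a | punchedIn b = trans (·-extendByZero-punchIn i X A _ b) (A·X≈0 a b)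

    Y≈0 : IsZero Y
    Y≈0 = snip Y (extendByZero-symmetric i X X-sym) (extendByZero-hadamardZero i X A AX≈0)
               (extendByZero-diagZero i X X-diag) A·Y-offRowᵢ

lemma3p6 : ∀ {c ℓ} (R : CommutativeRing c ℓ) → let open MatrixDefs R in
    (m : ℕ) (A : Matrix (suc m)) (i : Fin (suc m)) →
    Symmetric A → SNIP i A → SAP A × SAP (delete i A)
lemma3p6 R m A i _ snip = SNIP⇒SAP R snip , SNIP⇒SAP-delete R snip
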